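{- If $t\in\mathsf{no}_n$, then there exist a context $\Gamma$, a type $\sigma$ and a tight derivation in system $\mathcal{N}$ of $\Gamma\vdash^{(0,0,|t|_n)} t:\sigma$.
   Context: Terms are $t,u,r ::= x \mid \lambda x.t \mid t\,u \mid t[x\backslash u]$ over a countably infinite set of variables, where $t[x\backslash u]$ (explicit substitution) binds $x$ in $t$; terms are taken modulo $\alpha$-conversion. CBN neutral and normal terms: $\mathsf{ne}_n ::= x \mid \mathsf{ne}_n\, t$ and $\mathsf{no}_n ::= \lambda x.\mathsf{no}_n \mid \mathsf{ne}_n$. The $n$-size is $|x|_n=0$, $|\lambda x.t|_n = |t|_n+1$, $|t\,u|_n = |t|_n+1$, $|t[x\backslash u]|_n = |t|_n$. Types. Tight types: $\mathtt{tt} ::= \mathtt{n} \mid \mathtt{a}$. Types: $\sigma,\tau ::= \mathtt{tt} \mid \mathcal{M} \mid \mathcal{M}\to\sigma$, where multitypes $\mathcal{M} = [\sigma_i]_{i\in I}$ are finite multisets of types ($[\,]$ empty, $\sqcup$ union). A typing context $\Gamma$ maps variables to multitypes, $[\,]$ for all but finitely many; $\mathrm{dom}(\Gamma)=\{x \mid \Gamma(x)\neq[\,]\}$; $(\Gamma+\Delta)(x) = \Gamma(x)\sqcup\Delta(x)$, extended to finite sums $+_{i\in I}\Gamma_i$; $\Gamma\setminus\!\!\setminus x$ maps $x$ to $[\,]$ and agrees with $\Gamma$ elsewhere; $\Gamma; x:\mathcal{M}$ maps $x$ to $\mathcal{M}$ and agrees with $\Gamma$ elsewhere, where $x\notin\mathrm{dom}(\Gamma)$.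 Judgements $\Gamma \vdash^{(m,e,s)} t:\sigma$ carry natural-number counters. System $\mathcal{N}$ consists of the rules: (app$_p$) from $\Gamma\vdash^{(m,e,s)} t:\mathtt{n}$ infer $\Gamma\vdash^{(m,e,s+1)} t\,u:\mathtt{n}$; (abs$_p$) from $\Gamma\vdash^{(m,e,s)} t:\mathtt{tt}$ (a tight type) with $\Gamma(x)$ tight, infer $\Gamma\setminus\!\!\setminus x\vdash^{(m,e,s+1)}\lambda x.t:\mathtt{a}$; (var$_c$) $x:[\sigma]\vdash^{(0,0,0)} x:\sigma$; (abs$_c$) from $\Gamma\vdash^{(m,e,s)} t:\tau$ infer $\Gamma\setminus\!\!\setminus x\vdash^{(m,e,s)}\lambda x.t:\Gamma(x)\to\tau$; (app$_c$) from $\Gamma\vdash^{(m,e,s)} t:[\sigma_i]_{i\in I}\to\tau$ and $\Delta_i\vdash^{(m_i,e_i,s_i)} u:\sigma_i$ for each $i\in I$, infer $\Gamma+_{i\in I}\Delta_i\vdash^{(1+m+\sum_i m_i,\,1+e+\sum_i e_i,\,s+\sum_i s_i)} t\,u:\tau$; (es$_c$) from $\Gamma;x:[\sigma_i]_{i\in I}\vdash^{(m,e,s)} t:\tau$ and $\Delta_i\vdash^{(m_i,e_i,s_i)} u:\sigma_i$ for each $i\in I$, infer $(\Gamma\setminus\!\!\setminus x)+_{i\in I}\Delta_i\vdash^{(m+\sum_i m_i,\,1+e+\sum_i e_i,\,s+\sum_i s_i)} t[x\backslash u]:\tau$. A multitype is tight if all its elements are tight types; a context is tight if all multitypes it assigns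 are tight; a derivation of $\Gamma\vdash^{(m,e,s)} t:\sigma$ is tight if $\Gamma$ is tight and $\sigma$ is a tight type. -}

module Defs where

open import Data.Nat using (ℕ; zero; suc; _+_; _≡ᵇ_)
open import Data.Bool using (if_then_else_)
open import Data.List using (List; []; _∷_; _++_)
open import Data.List.Relation.Unary.All using (All)
open import Data.Product using (Σ; _×_)

Var : Set
Var = ℕ

data Term : Set where
  var : Var → Term
  lam : Var → Term → Term
  app : Term → Term → Term
  es  : Term → Var → Term → Term   -- es t x u  =  t[x\u]

mutual
  data NeN : Term → Set where
    ne-var : ∀ x → NeN (var x)
    ne-app : ∀ {t} → NeN t → ∀ u → NeN (app t u)

  data NoN : Term → Set where
    no-lam : ∀ x {t} → NoN t → NoN (lam x t)
    no-ne  : ∀ {t} → NeN t → NoN t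

sizeN : Term → ℕ
sizeN (var x)    = 0
sizeN (lam x t)  = suc (sizeN t)
sizeN (app t u)  = suc (sizeN t)
sizeN (es t x u) = sizeN t

-- Types; multitypes are finite multisets, represented as lists.
data Ty : Set where
  tn  : Ty
  ta  : Ty
  mul : List Ty → Ty
  arr : List Ty → Ty → Ty

MTy : Set
MTy = List Ty

data Tight : Ty → Set where
  tight-n : Tight tn
  tight-a : Tight ta

TightM : MTy → Set
TightM = All Tight

Ctx : Set
Ctx = Var → MTy

∅ : Ctx
∅ _ = []

_⊕_ : Ctx → Ctx → Ctx
(Γ ⊕ Δ) y = Γ y ++ Δ y

_∖∖_ : Ctx → Var → Ctx
(Γ ∖∖ x) y = if y ≡ᵇ x then [] else Γ y

single : Var → Ty → Ctx
single x σ y = if y ≡ᵇ x then σ ∷ [] else []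

TightCtx : Ctx → Set
TightCtx Γ = ∀ x → TightM (Γ x)

mutual
  data _⊢_∶_⟨_,_,_⟩ : Ctx → Term → Ty → ℕ → ℕ → ℕ → Set where
    app-p : ∀ {Γ t m e s} u →
            Γ ⊢ t ∶ tn ⟨ m , e , s ⟩ →
            Γ ⊢ app t u ∶ tn ⟨ m , e , suc s ⟩
    abs-p : ∀ {Γ t τ m e s} x →
            Tight τ → TightM (Γ x) →
            Γ ⊢ t ∶ τ ⟨ m , e , s ⟩ →
            (Γ ∖∖ x) ⊢ lam x t ∶ ta ⟨ m , e , suc s ⟩
    var-c : ∀ x σ →
            single x σ ⊢ var x ∶ σ ⟨ 0 , 0 , 0 ⟩
    abs-c : ∀ {Γ t τ m e s} x →
            Γ ⊢ t ∶ τ ⟨ m , e , s ⟩ →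
            (Γ ∖∖ x) ⊢ lam x t ∶ arr (Γ x) τ ⟨ m , e , s ⟩
    app-c : ∀ {Γ Δ t u M τ m e s m' e' s'} →
            Γ ⊢ t ∶ arr M τ ⟨ m , e , s ⟩ →
            Many Δ u M m' e' s' →
            (Γ ⊕ Δ) ⊢ app t u ∶ τ ⟨ suc (m + m') , suc (e + e') , s + s' ⟩
    -- premise context Γ;x:M is written Π with M = Π x, Γ = Π \\ x
    es-c  : ∀ {Π Δ t u x τ m e s m' e' s'} →
            Π ⊢ t ∶ τ ⟨ m , e , s ⟩ →
            Many Δ u (Π x) m' e' s' →
            ((Π ∖∖ x) ⊕ Δ) ⊢ es t x u ∶ τ ⟨ m + m' , suc (e + e') , s + s' ⟩

  -- A family of derivations Δ_i ⊢ u : σ_i (i ∈ I), for M = [σ_i]_{i∈I},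
  -- together with the sum of their contexts and counters.
  data Many : Ctx → Term → MTy → ℕ → ℕ → ℕ → Set where
    many-[] : ∀ {u} → Many ∅ u [] 0 0 0
    many-∷  : ∀ {Δ Δ' u σ M m e s m' e' s'} →
              Δ ⊢ u ∶ σ ⟨ m , e , s ⟩ →
              Many Δ' u M m' e' s' →
              Many (Δ ⊕ Δ') u (σ ∷ M) (m + m') (e + e') (s + s')

TightDeriv : Ctx → Term → Ty → ℕ → ℕ → ℕ → Set
TightDeriv Γ t σ m e s = (Γ ⊢ t ∶ σ ⟨ m , e , s ⟩) × TightCtx Γ × Tight σ

{-# OPTIONS --safe #-}
-- Normal forms are typed by the persistent rules alone: a neutral term gets
-- type n from var-c at type n followed by app-p, and each leading abstraction
-- is then closed by abs-p, whose side conditions are preserved because every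
-- context in sight assigns only tight types. Persistent rules count only in
-- the size component, which therefore equals the n-size of the term.
module Submission where

open import Defs
open import Data.Product using (Σ; _,_; _×_)
open import Data.Nat using (_≡ᵇ_)
open import Data.Bool using (true; false)
open import Data.List.Relation.Unary.All using ([]; _∷_)

single-tight : ∀ x {σ} → Tight σ → TightCtx (single x σ)
single-tight x tσ y with y ≡ᵇ x
... | true  = tσ ∷ []
... | false = []

∖∖-tight : ∀ {Γ} x → TightCtx Γ → TightCtx (Γ ∖∖ x)
∖∖-tight x tΓ y with y ≡ᵇ x
... | true  = []
... | false = tΓ y

NeutralTyping : Term → Set
NeutralTyping t = Σ Ctx (λ Γ → (Γ ⊢ t ∶ tn ⟨ 0 , 0 , sizeN t ⟩) × TightCtx Γ)

neutral-typing : ∀ {t} → NeN t → NeutralTyping t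
neutral-typing (ne-var x)   = single x tn , var-c x tn , single-tight x tight-n
neutral-typing (ne-app n u) =
  let (Γ , d , tΓ) = neutral-typing n in Γ , app-p u d , tΓ

lemma3p7 : (t : Term) → NoN t →
    Σ Ctx (λ Γ → Σ Ty (λ σ → TightDeriv Γ t σ 0 0 (sizeN t)))
lemma3p7 _ (no-lam x {t} n) =
  let (Γ , σ , d , tΓ , tσ) = lemma3p7 t n
  in  Γ ∖∖ x , ta , abs-p x tσ (tΓ x) d , ∖∖-tight x tΓ , tight-a
lemma3p7 _ (no-ne n) =
  let (Γ , d , tΓ) = neutral-typing n
  in  Γ , tn , d , tΓ , tight-n
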